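{- Let $l$ be a positive integer, and let $n\geqslant 0$ be an integer such that each of the four integers $n+1,n+2,n+3,n+4$ has exactly $l$ decimal digits (i.e. $Sm(n),Sm(n+1),Sm(n+2),Sm(n+3)$ are all Smarandache numbers of the $l$-digit right-concatenation). Then $$Sm(n+3)-(10^l+2)\,Sm(n+2)+(2\cdot 10^l+1)\,Sm(n+1)-10^l\,Sm(n)=0 .$$
   Context: For an integer $n\geqslant 0$, the Smarandache number $Sm(n)$ is the positive integer whose decimal representation is the concatenation of the decimal representations of $1,2,\ldots,n+1$ (so $Sm(0)=1$, $Sm(1)=12$, $Sm(2)=123$, $Sm(9)=12345678910$). Equivalently $Sm(0)=1$ and $Sm(n+1)=10^{k}\,Sm(n)+(n+2)$ where $k$ is the number of decimal digits of $n+2$. The "$l$-digit right-concatenation" terms are the $Sm(m)$ for which the last appended number $m+1$ has exactly $l$ digits. -}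

module Defs where

open import Data.Nat using (ℕ; zero; suc; _+_; _*_; _^_; _<_; _≤_; _<ᵇ_)
open import Data.Bool using (true; false)
open import Data.Nat.DivMod using (_/_)

-- number of decimal digits of m, computed with fuel (fuel ≥ m suffices)
-- digitsAux fuel m : repeatedly divide by 10 until the value is < 10
digitsAux : ℕ → ℕ → ℕ
digitsAux zero    m = 1
digitsAux (suc f) m with m <ᵇ 10
... | true  = 1
... | false = suc (digitsAux f (m / 10))

numDigits : ℕ → ℕ
numDigits m = digitsAux m m

Sm : ℕ → ℕ
Sm zero    = 1
Sm (suc n) = 10 ^ numDigits (suc (suc n)) * Sm n + suc (suc n)

-- While the appended numbers all have l digits, Sm obeys s(k+1) = T s(k) + (k+2) with
-- T = 10^l, a first-order recurrence whose inhomogeneous term is linear in k.  Such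
-- sequences satisfy the homogeneous recurrence with characteristic polynomial
-- (x - T)(x - 1)² = x³ - (T + 2)x² + (2T + 1)x - T, which is the claimed identity.
module Submission where

open import Defs
open import Data.Nat using (ℕ; suc; _≤_; _^_) renaming (_*_ to _*ℕ_; _+_ to _+ℕ_)
open import Data.Nat.Properties using (+-suc; +-identityʳ)
open import Data.Integer using (ℤ; +_; _+_; _-_; _*_)
open import Data.Integer.Properties using (pos-+; pos-*)
open import Data.Integer.Tactic.RingSolver using (solve-∀)
open import Relation.Binary.PropositionalEquality using (_≡_; refl; cong; cong₂; trans; sym; subst; module ≡-Reasoning)

Sm-step : ∀ {l} n k → numDigits (n +ℕ suc (suc k)) ≡ l →
          + Sm (n +ℕ suc k) ≡ + (10 ^ l) * + Sm (n +ℕ k) + (+ n + + suc (suc k))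
Sm-step {l} n k digits = begin
  + Sm (n +ℕ suc k)                                   ≡⟨ cong (λ m → + Sm m) (+-suc n k) ⟩
  + Sm (suc (n +ℕ k))                                 ≡⟨ cong +_ (cong₂ (λ d j → 10 ^ d *ℕ Sm (n +ℕ k) +ℕ j) digits′ (sym n+k+2)) ⟩
  + (10 ^ l *ℕ Sm (n +ℕ k) +ℕ (n +ℕ suc (suc k)))     ≡⟨ pos-+ (10 ^ l *ℕ Sm (n +ℕ k)) _ ⟩
  + (10 ^ l *ℕ Sm (n +ℕ k)) + + (n +ℕ suc (suc k))    ≡⟨ cong₂ _+_ (pos-* (10 ^ l) _) (pos-+ n _) ⟩
  + (10 ^ l) * + Sm (n +ℕ k) + (+ n + + suc (suc k))  ∎
  where
  open ≡-Reasoning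
  n+k+2 : n +ℕ suc (suc k) ≡ suc (suc (n +ℕ k))
  n+k+2 = trans (+-suc n (suc k)) (cong suc (+-suc n k))
  digits′ : numDigits (suc (suc (n +ℕ k))) ≡ l
  digits′ = trans (cong numDigits (sym n+k+2)) digits

annihilate-affine-recurrence : ∀ T m s₀ s₁ s₂ s₃ {c₁ c₂} → c₁ ≡ T + + 2 → c₂ ≡ + 2 * T + + 1 →
  s₁ ≡ T * s₀ + (m + + 2) → s₂ ≡ T * s₁ + (m + + 3) → s₃ ≡ T * s₂ + (m + + 4) →
  s₃ - c₁ * s₂ + c₂ * s₁ - T * s₀ ≡ + 0
annihilate-affine-recurrence T m s₀ _ _ _ refl refl refl refl refl = identity T m s₀
  where
  identity : ∀ T m s₀ →
    T * (T * (T * s₀ + (m + + 2)) + (m + + 3)) + (m + + 4)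
      - (T + + 2) * (T * (T * s₀ + (m + + 2)) + (m + + 3))
      + (+ 2 * T + + 1) * (T * s₀ + (m + + 2)) - T * s₀ ≡ + 0
  identity = solve-∀

lemma1 : (l n : ℕ) → 1 ≤ l →
    numDigits (n +ℕ 1) ≡ l → numDigits (n +ℕ 2) ≡ l →
    numDigits (n +ℕ 3) ≡ l → numDigits (n +ℕ 4) ≡ l →
    (+ Sm (n +ℕ 3)) - (+ (10 ^ l +ℕ 2)) * (+ Sm (n +ℕ 2))
    + (+ (2 *ℕ 10 ^ l +ℕ 1)) * (+ Sm (n +ℕ 1)) - (+ (10 ^ l)) * (+ Sm n) ≡ + 0
lemma1 l n _ _ d₂ d₃ d₄ =
  annihilate-affine-recurrence (+ (10 ^ l)) (+ n) (+ Sm n) _ _ _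
    (pos-+ (10 ^ l) 2) second-coefficient
    step₁ (Sm-step n 1 d₃) (Sm-step n 2 d₄)
  where
  second-coefficient : + (2 *ℕ 10 ^ l +ℕ 1) ≡ + 2 * + (10 ^ l) + + 1
  second-coefficient = trans (pos-+ (2 *ℕ 10 ^ l) 1) (cong (_+ + 1) (pos-* 2 (10 ^ l)))
  step₁ : + Sm (n +ℕ 1) ≡ + (10 ^ l) * + Sm n + (+ n + + 2)
  step₁ = subst (λ m → + Sm (n +ℕ 1) ≡ + (10 ^ l) * + Sm m + (+ n + + 2))
                (+-identityʳ n) (Sm-step n 0 d₂)
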